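{- Let $\mathcal{M}_n\subseteq\mathrm{Mat}_{n\times n}(\mathbb{C})$ be the set of permutation matrices of involutions in $\mathfrak{S}_n$. Let $I^{\mathcal{M}}_n\subseteq\mathbb{C}[\mathbf{x}_{n\times n}]$ be the ideal generated by all row sums $x_{i,1}+\cdots+x_{i,n}$, all column sums $x_{1,j}+\cdots+x_{n,j}$, all products $x_{i,j}x_{i,j'}$, all products $x_{i,j}x_{i',j}$, and all differences $x_{i,j}-x_{j,i}$ ($1\le i,i',j,j'\le n$). Then $I^{\mathcal{M}}_n\subseteq\mathrm{gr}\,\mathbf{I}(\mathcal{M}_n)$.
   Context: $\mathbf{x}_{n\times n}=(x_{i,j})$ is a matrix of variables. For finite $\mathcal{Z}\subseteq\mathrm{Mat}_{n\times n}(\mathbb{C})$, $\mathbf{I}(\mathcal{Z})$ is the ideal of polynomials vanishing on $\mathcal{Z}$, and $\mathrm{gr}\,\mathbf{I}(\mathcal{Z})$ is the ideal generated by the top-degree homogeneous components of its nonzero elements. -}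

module Defs where

open import Level using (Level; _⊔_) renaming (suc to lsuc)
open import Algebra.Bundles using (CommutativeRing)
open import Data.Nat as ℕ using (ℕ; _≤_)
open import Data.Fin using (Fin)
open import Data.Fin.Properties using () renaming (_≟_ to _≟F_)
open import Data.Vec using (Vec; lookup)
open import Data.Vec.Properties using (≡-dec)
open import Data.List using (List; []; _∷_; map; concatMap)
import Data.List
import Data.Vec
import Data.Product
import Data.List.Relation.Unary.All
import Relation.Nullary
open import Data.Product using (Σ; ∃; ∃-syntax; _×_; _,_)
open import Relation.Nullary using (¬_; yes; no)
open import Relation.Binary.PropositionalEquality using (_≡_)

record Field (c ℓ : Level) : Set (lsuc (c ⊔ ℓ)) where
  field
    commutativeRing : CommutativeRing c ℓ
  open CommutativeRing commutativeRing public
  field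
    1#≉0#   : ¬ (1# ≈ 0#)
    inverse : ∀ x → ¬ (x ≈ 0#) → ∃[ y ] (x * y ≈ 1#)

module Poly {c ℓ} (K : Field c ℓ) where
  open Field K

  -- A monomial  ∏ x_{i,j}^{e i j}  is its exponent matrix (row i, column j).
  Mono : ℕ → Set
  Mono n = Vec (Vec ℕ n) n

  exp : ∀ {n} → Mono n → Fin n → Fin n → ℕ
  exp m i j = lookup (lookup m i) j

  _≟M_ : ∀ {n} (m m' : Mono n) → Relation.Nullary.Dec (m ≡ m')
  _≟M_ = ≡-dec (≡-dec ℕ._≟_)

  unitMono : ∀ {n} → Mono n
  unitMono = Data.Vec.replicate _ (Data.Vec.replicate _ 0)

  _·M_ : ∀ {n} → Mono n → Mono n → Mono n
  m ·M m' = Data.Vec.zipWith (Data.Vec.zipWith ℕ._+_) m m'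

  varMono : ∀ {n} → Fin n → Fin n → Mono n
  varMono i j = Data.Vec.tabulate λ i' → Data.Vec.tabulate λ j' →
    isOne i' j'
    where
    isOne : _ → _ → ℕ
    isOne i' j' with i ≟F i' | j ≟F j'
    ... | yes _ | yes _ = 1
    ... | _     | _     = 0

  deg : ∀ {n} → Mono n → ℕ
  deg m = Data.Vec.sum (Data.Vec.map Data.Vec.sum m)

  -- A polynomial is a formal finite sum of terms  c · monomial.
  Pol : ℕ → Set c
  Pol n = List (Carrier × Mono n)

  coeff : ∀ {n} → Pol n → Mono n → Carrier
  coeff []             m = 0#
  coeff ((a , m') ∷ f) m with m' ≟M m
  ... | yes _ = a + coeff f m
  ... | no  _ = coeff f m

  _≈P_ : ∀ {n} → Pol n → Pol n → Set ℓ
  f ≈P g = ∀ m → coeff f m ≈ coeff g m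

  0P : ∀ {n} → Pol n
  0P = []

  constP : ∀ {n} → Carrier → Pol n
  constP a = (a , unitMono) ∷ []

  varP : ∀ {n} → Fin n → Fin n → Pol n
  varP i j = (1# , varMono i j) ∷ []

  _+P_ : ∀ {n} → Pol n → Pol n → Pol n
  f +P g = f Data.List.++ g

  -P_ : ∀ {n} → Pol n → Pol n
  -P f = map (λ { (a , m) → (- a , m) }) f

  _-P_ : ∀ {n} → Pol n → Pol n → Pol n
  f -P g = f +P (-P g)

  _*P_ : ∀ {n} → Pol n → Pol n → Pol n
  f *P g = concatMap (λ { (a , m) → map (λ { (b , m') → (a * b , m ·M m') }) g }) f

  ΣP : ∀ {n} → List (Pol n) → Pol n
  ΣP = Data.List.foldr _+P_ 0P

  _^_ : Carrier → ℕ → Carrier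
  a ^ ℕ.zero  = 1#
  a ^ ℕ.suc k = a * (a ^ k)

  evalMono : ∀ {n} → (Fin n → Fin n → Carrier) → Mono n → Carrier
  evalMono {n} z m =
    Data.List.foldr _*_ 1#
      (concatMap (λ i → map (λ j → z i j ^ exp m i j) (Data.List.allFin n))
                 (Data.List.allFin n))

  eval : ∀ {n} → (Fin n → Fin n → Carrier) → Pol n → Carrier
  eval z f = Data.List.foldr _+_ 0# (map (λ { (a , m) → a * evalMono z m }) f)

  NonZeroP : ∀ {n} → Pol n → Set ℓ
  NonZeroP {n} f = ∃[ m ] ¬ (coeff f m ≈ 0#)

  IsTopComponent : ∀ {n} → Pol n → Pol n → Set ℓ
  IsTopComponent {n} g f = ∃[ d ]
      ((∀ m → ¬ (coeff f m ≈ 0#) → deg m ≤ d)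
    × (∃[ m ] (deg m ≡ d × ¬ (coeff f m ≈ 0#)))
    × (∀ m → deg m ≡ d → coeff g m ≈ coeff f m)
    × (∀ m → ¬ (deg m ≡ d) → coeff g m ≈ 0#))

  _∈⟨_⟩ : ∀ {n} {p} → Pol n → (Pol n → Set p) → Set (c ⊔ ℓ ⊔ p)
  _∈⟨_⟩ {n} f S = Σ (List (Pol n × Pol n)) λ hs → ((Data.List.Relation.Unary.All.All (λ (hs : Pol n × Pol n) → S (Data.Product.proj₂ hs)) hs)
                   × (f ≈P ΣP (map (λ { (h , s) → h *P s }) hs)))

  I : ∀ {n} {p} → ((Fin n → Fin n → Carrier) → Set p) → Pol n → Set (c ⊔ ℓ ⊔ p)
  I Z f = ∀ z → Z z → eval z f ≈ 0#

  grGens : ∀ {n} {p} → ((Fin n → Fin n → Carrier) → Set p) → Pol n → Set (c ⊔ ℓ ⊔ p)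
  grGens Z g = ∃[ f ] (I Z f × NonZeroP f × IsTopComponent g f)

  gr-I : ∀ {n} {p} → ((Fin n → Fin n → Carrier) → Set p) → Pol n → Set (c ⊔ ℓ ⊔ p)
  gr-I Z f = f ∈⟨ grGens Z ⟩

  permMatrix : ∀ {n} → (Fin n → Fin n) → Fin n → Fin n → Carrier
  permMatrix σ i j with σ i ≟F j
  ... | yes _ = 1#
  ... | no  _ = 0#

  -- σ is an involution in S_n (σ ∘ σ = id, hence a bijection)
  IsInvolution : ∀ {n} → (Fin n → Fin n) → Set
  IsInvolution σ = ∀ i → σ (σ i) ≡ i

  ℳ : ∀ n → (Fin n → Fin n → Carrier) → Set ℓ
  ℳ n z = ∃[ σ ] (IsInvolution σ × (∀ i j → z i j ≈ permMatrix σ i j))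

  rowSum : ∀ {n} → Fin n → Pol n
  rowSum {n} i = ΣP (map (λ j → varP i j) (Data.List.allFin n))

  colSum : ∀ {n} → Fin n → Pol n
  colSum {n} j = ΣP (map (λ i → varP i j) (Data.List.allFin n))

  data GensM {n : ℕ} : Pol n → Set c where
    row  : ∀ i → GensM (rowSum i)
    col  : ∀ j → GensM (colSum j)
    rowP : ∀ i j j' → GensM (varP i j *P varP i j')
    colP : ∀ i i' j → GensM (varP i j *P varP i' j)
    symm : ∀ i j → GensM (varP i j -P varP j i)

  IM : ∀ n → Pol n → Set (c ⊔ ℓ)
  IM n f = f ∈⟨ GensM {n} ⟩

-- Every generator s of I^ℳ_n except x_ii − x_ii (the zero polynomial, which drops out of any
-- combination) is nonzero and homogeneous of some degree d, and agrees on ℳ_n with a polynomial r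
-- of degree < d; so s is the top component of s − r ∈ I(ℳ_n). Row and column sums agree with 1,
-- x_ij² agrees with x_ij (entries are 0 or 1), and x_ij x_ij' (j ≠ j'), x_ij x_i'j (i ≠ i') and
-- x_ij − x_ji (i ≠ j) vanish on ℳ_n, since each row holds a single 1 and the permutation matrix
-- of an involution is symmetric.

module Submission where

open import Defs
open import Level using (Level; _⊔_)
open import Data.Nat using (ℕ)

open import Algebra.Bundles using (CommutativeMonoid)
import Algebra.Properties.CommutativeMonoid.Sum as MonoidSum
import Algebra.Properties.CommutativeSemigroup as CommutativeSemigroupProperties
import Algebra.Properties.Ring as RingProperties
open import Data.Fin using (Fin; zero; suc)
open import Data.Fin.Properties using (punchInᵢ≢i) renaming (_≟_ to _≟F_)
open import Data.List using (List; []; _∷_; _++_; foldr; map; concatMap; allFin)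
import Data.List as List
open import Data.List.Properties using (map-tabulate; map-++)
open import Data.List.Relation.Unary.All using (All; []; _∷_)
import Data.Nat as ℕ
open import Data.Nat.Properties
  using (+-0-commutativeMonoid; _≤?_; ≤-reflexive; <⇒≤; ≰⇒>; <⇒≱; n<1+n; 1+n≢0)
open import Data.Product using (∃-syntax; _×_; _,_; proj₂)
open import Data.Product.Properties using (,-injectiveˡ; ,-injectiveʳ)
import Data.Product.Properties as Product
open import Data.Sum using (_⊎_; inj₁; inj₂)
open import Data.Vec as Vec using (Vec; []; _∷_; lookup)
open import Data.Vec.Functional using (Vector; removeAt)
open import Data.Vec.Properties
  using (lookup-zipWith; lookup-replicate; lookup∘tabulate; lookup-map)
open import Function.Base using (id; _∘_; _∋_)
open import Relation.Nullary using (yes; no; contradiction)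
open import Relation.Binary.PropositionalEquality as ≡ using (_≡_; _≢_)

module FiniteSums {c ℓ} (M : CommutativeMonoid c ℓ) where
  open CommutativeMonoid M
  open MonoidSum M public using (sum; sum-cong-≋; sum-cong-≗; ∑-distrib-+)
  open MonoidSum M using (sum-remove; sum-replicate-zero)
  open import Relation.Binary.Reasoning.Setoid setoid

  sum-ε : ∀ {k} {t : Vector Carrier k} → (∀ i → t i ≈ ε) → sum t ≈ ε
  sum-ε {k} t≈ε = trans (sum-cong-≋ t≈ε) (sum-replicate-zero k)

  sum-single : ∀ {k} (t : Vector Carrier k) i → (∀ j → j ≢ i → t j ≈ ε) → sum t ≈ t i
  sum-single {ℕ.suc k} t i t≈ε = begin
    sum t                    ≈⟨ sum-remove t ⟩
    t i ∙ sum (removeAt t i) ≈⟨ ∙-congˡ (sum-ε (λ j → t≈ε _ (punchInᵢ≢i i j))) ⟩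
    t i ∙ ε                  ≈⟨ identityʳ (t i) ⟩
    t i                      ∎

  foldr-++ : ∀ xs ys → foldr _∙_ ε (xs ++ ys) ≈ foldr _∙_ ε xs ∙ foldr _∙_ ε ys
  foldr-++ []       ys = sym (identityˡ _)
  foldr-++ (x ∷ xs) ys = trans (∙-congˡ (foldr-++ xs ys)) (sym (assoc _ _ _))

  foldr-concatMap : ∀ {a} {A : Set a} (G : A → List Carrier) xs →
    foldr _∙_ ε (concatMap G xs) ≈ foldr _∙_ ε (map (foldr _∙_ ε ∘ G) xs)
  foldr-concatMap G []       = refl
  foldr-concatMap G (x ∷ xs) = trans (foldr-++ (G x) _) (∙-congˡ (foldr-concatMap G xs))

  foldr-tabulate : ∀ {k} (t : Vector Carrier k) → foldr _∙_ ε (List.tabulate t) ≡ sum t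
  foldr-tabulate {ℕ.zero}  t = ≡.refl
  foldr-tabulate {ℕ.suc k} t = ≡.cong (t zero ∙_) (foldr-tabulate (t ∘ suc))

  foldr-map-allFin : ∀ {k} (t : Vector Carrier k) → foldr _∙_ ε (map t (allFin k)) ≈ sum t
  foldr-map-allFin t =
    reflexive (≡.trans (≡.cong (foldr _∙_ ε) (map-tabulate id t)) (foldr-tabulate t))

  sum₂ : ∀ {k l} → (Fin k → Fin l → Carrier) → Carrier
  sum₂ t = sum (λ a → sum (t a))

  sum₂-cong : ∀ {k l} {t u : Fin k → Fin l → Carrier} → (∀ a b → t a b ≈ u a b) → sum₂ t ≈ sum₂ u
  sum₂-cong t≈u = sum-cong-≋ (λ a → sum-cong-≋ (t≈u a))

  sum₂-distrib : ∀ {k l} (t u : Fin k → Fin l → Carrier) →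
    sum₂ (λ a b → t a b ∙ u a b) ≈ sum₂ t ∙ sum₂ u
  sum₂-distrib t u = trans (sum-cong-≋ (λ a → ∑-distrib-+ (t a) (u a)))
                           (∑-distrib-+ (λ a → sum (t a)) (λ a → sum (u a)))

  sum₂-ε : ∀ {k l} {t : Fin k → Fin l → Carrier} → (∀ a b → t a b ≈ ε) → sum₂ t ≈ ε
  sum₂-ε t≈ε = sum-ε (λ a → sum-ε (t≈ε a))

  sum₂-single : ∀ {k l} (t : Fin k → Fin l → Carrier) i j →
    (∀ a b → (a , b) ≢ (i , j) → t a b ≈ ε) → sum₂ t ≈ t i j
  sum₂-single t i j t≈ε = trans
    (sum-single (λ a → sum (t a)) i (λ a a≢i → sum-ε (λ b → t≈ε a b (a≢i ∘ ,-injectiveˡ))))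
    (sum-single (t i) j (λ b b≢j → t≈ε i b (b≢j ∘ ,-injectiveʳ)))

  foldr-concatMap-allFin : ∀ {k l} (t : Fin k → Fin l → Carrier) →
    foldr _∙_ ε (concatMap (λ a → map (t a) (allFin l)) (allFin k)) ≈ sum₂ t
  foldr-concatMap-allFin {k} {l} t = begin
    foldr _∙_ ε (concatMap (λ a → map (t a) (allFin l)) (allFin k))
      ≈⟨ foldr-concatMap (λ a → map (t a) (allFin l)) (allFin k) ⟩
    foldr _∙_ ε (map (λ a → foldr _∙_ ε (map (t a) (allFin l))) (allFin k))
      ≈⟨ foldr-map-allFin (λ a → foldr _∙_ ε (map (t a) (allFin l))) ⟩
    sum (λ a → foldr _∙_ ε (map (t a) (allFin l)))
      ≈⟨ sum-cong-≋ (λ a → foldr-map-allFin (t a)) ⟩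
    sum₂ t
      ∎

module ∑ℕ = FiniteSums +-0-commutativeMonoid

Vec-sum≡∑-lookup : ∀ {k} (xs : Vec ℕ k) → Vec.sum xs ≡ ∑ℕ.sum (lookup xs)
Vec-sum≡∑-lookup []       = ≡.refl
Vec-sum≡∑-lookup (x ∷ xs) = ≡.cong (x ℕ.+_) (Vec-sum≡∑-lookup xs)

module _ {c ℓ} (K : Field c ℓ) where
  open Field K hiding (zero)
  open Poly K
  open RingProperties ring using (-0#≈0#; -‿+-comm; -‿distribˡ-*; x≈y⇒x∙y⁻¹≈ε)
  open CommutativeSemigroupProperties *-commutativeSemigroup
    using () renaming (interchange to *-interchange)
  open import Relation.Binary.Reasoning.Setoid setoid
  module ∑ = FiniteSums +-commutativeMonoid
  module ∏ = FiniteSums *-commutativeMonoid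

  Matrix : ℕ → Set c
  Matrix n = Fin n → Fin n → Carrier

  ≈1⇒≉0 : ∀ {x} → x ≈ 1# → x ≉ 0#
  ≈1⇒≉0 x≈1 x≈0 = 1#≉0# (trans (sym x≈1) x≈0)

  exp-tabulate : ∀ {n} (e : Fin n → Fin n → ℕ) a b →
    exp (Vec.tabulate λ a → Vec.tabulate λ b → e a b) a b ≡ e a b
  exp-tabulate e a b =
    ≡.trans (≡.cong (λ row → lookup row b) (lookup∘tabulate _ a)) (lookup∘tabulate _ b)

  -- The entry function of `varMono` is `where`-local, so `exp-tabulate _` names it by unification.
  exp-varMono-≡ : ∀ {n} (i j : Fin n) → exp (varMono i j) i j ≡ 1
  exp-varMono-≡ i j rewrite (exp (varMono i j) i j ≡ _ ∋ exp-tabulate _ i j)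
    with i ≟F i | j ≟F j
  ... | yes _   | yes _   = ≡.refl
  ... | no i≢i  | _       = contradiction ≡.refl i≢i
  ... | yes _   | no j≢j  = contradiction ≡.refl j≢j

  exp-varMono-≢ : ∀ {n} {i j a b : Fin n} → (a , b) ≢ (i , j) → exp (varMono i j) a b ≡ 0
  exp-varMono-≢ {i = i} {j} {a} {b} ab≢ij
    rewrite (exp (varMono i j) a b ≡ _ ∋ exp-tabulate _ a b) with i ≟F a | j ≟F b
  ... | yes ≡.refl | yes ≡.refl = contradiction ≡.refl ab≢ij
  ... | yes _      | no _       = ≡.refl
  ... | no _       | _          = ≡.refl

  exp-·M : ∀ {n} (m m' : Mono n) i j → exp (m ·M m') i j ≡ exp m i j ℕ.+ exp m' i j
  exp-·M m m' i j = ≡.trans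
    (≡.cong (λ row → lookup row j) (lookup-zipWith (Vec.zipWith ℕ._+_) i m m'))
    (lookup-zipWith ℕ._+_ j (lookup m i) (lookup m' i))

  exp-unitMono : ∀ {n} (i j : Fin n) → exp (unitMono {n}) i j ≡ 0
  exp-unitMono {n} i j =
    ≡.trans (≡.cong (λ row → lookup row j) (lookup-replicate i _)) (lookup-replicate j 0)

  varMono-injective : ∀ {n} {i j a b : Fin n} → varMono i j ≡ varMono a b → (i , j) ≡ (a , b)
  varMono-injective {i = i} {j} {a} {b} eq with Product.≡-dec _≟F_ _≟F_ (i , j) (a , b)
  ... | yes ij≡ab = ij≡ab
  ... | no ij≢ab  = contradiction (≡.trans (≡.sym (exp-varMono-≡ i j))
                     (≡.trans (≡.cong (λ m → exp m i j) eq) (exp-varMono-≢ ij≢ab))) 1+n≢0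

  deg-as-∑ : ∀ {n} (m : Mono n) → deg m ≡ ∑ℕ.sum₂ (exp m)
  deg-as-∑ m = ≡.trans (Vec-sum≡∑-lookup (Vec.map Vec.sum m)) (∑ℕ.sum-cong-≗ λ a →
    ≡.trans (lookup-map a Vec.sum m) (Vec-sum≡∑-lookup (lookup m a)))

  deg-·M : ∀ {n} (m m' : Mono n) → deg (m ·M m') ≡ deg m ℕ.+ deg m'
  deg-·M m m' = ≡.trans (deg-as-∑ (m ·M m'))
    (≡.trans (∑ℕ.sum₂-cong (exp-·M m m'))
    (≡.trans (∑ℕ.sum₂-distrib (exp m) (exp m'))
             (≡.sym (≡.cong₂ ℕ._+_ (deg-as-∑ m) (deg-as-∑ m')))))

  deg-unitMono : ∀ {n} → deg (unitMono {n}) ≡ 0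
  deg-unitMono {n} = ≡.trans (deg-as-∑ (unitMono {n})) (∑ℕ.sum₂-ε (exp-unitMono {n}))

  deg-varMono : ∀ {n} (i j : Fin n) → deg (varMono i j) ≡ 1
  deg-varMono i j = ≡.trans (deg-as-∑ (varMono i j))
    (≡.trans (∑ℕ.sum₂-single (exp (varMono i j)) i j (λ _ _ → exp-varMono-≢)) (exp-varMono-≡ i j))

  pow-+ : ∀ x k l → x ^ (k ℕ.+ l) ≈ x ^ k * x ^ l
  pow-+ x ℕ.zero    l = sym (*-identityˡ _)
  pow-+ x (ℕ.suc k) l = trans (*-congˡ (pow-+ x k l)) (sym (*-assoc _ _ _))

  powers : ∀ {n} → Matrix n → Mono n → Matrix n
  powers z m a b = z a b ^ exp m a b

  evalMono-as-∏ : ∀ {n} (z : Matrix n) m → evalMono z m ≈ ∏.sum₂ (powers z m)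
  evalMono-as-∏ z m = ∏.foldr-concatMap-allFin (powers z m)

  evalMono-·M : ∀ {n} (z : Matrix n) m m' → evalMono z (m ·M m') ≈ evalMono z m * evalMono z m'
  evalMono-·M z m m' = begin
    evalMono z (m ·M m')                       ≈⟨ evalMono-as-∏ z (m ·M m') ⟩
    ∏.sum₂ (powers z (m ·M m'))                ≈⟨ ∏.sum₂-cong powers-·M ⟩
    ∏.sum₂ (λ a b → powers z m a b * powers z m' a b) ≈⟨ ∏.sum₂-distrib (powers z m) (powers z m') ⟩
    ∏.sum₂ (powers z m) * ∏.sum₂ (powers z m') ≈⟨ *-cong (evalMono-as-∏ z m) (evalMono-as-∏ z m') ⟨
    evalMono z m * evalMono z m'               ∎
    where
    powers-·M : ∀ a b → powers z (m ·M m') a b ≈ powers z m a b * powers z m' a b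
    powers-·M a b = trans (reflexive (≡.cong (z a b ^_) (exp-·M m m' a b)))
                          (pow-+ (z a b) (exp m a b) (exp m' a b))

  evalMono-unitMono : ∀ {n} (z : Matrix n) → evalMono z unitMono ≈ 1#
  evalMono-unitMono {n} z = trans (evalMono-as-∏ z unitMono)
    (∏.sum₂-ε (λ a b → reflexive (≡.cong (z a b ^_) (exp-unitMono {n} a b))))

  evalMono-varMono : ∀ {n} (z : Matrix n) i j → evalMono z (varMono i j) ≈ z i j
  evalMono-varMono z i j = begin
    evalMono z (varMono i j)       ≈⟨ evalMono-as-∏ z (varMono i j) ⟩
    ∏.sum₂ (powers z (varMono i j)) ≈⟨ ∏.sum₂-single _ i j (λ a b ab≢ij →
                                         reflexive (≡.cong (z a b ^_) (exp-varMono-≢ ab≢ij))) ⟩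
    z i j ^ exp (varMono i j) i j  ≡⟨ ≡.cong (z i j ^_) (exp-varMono-≡ i j) ⟩
    z i j * 1#                     ≈⟨ *-identityʳ _ ⟩
    z i j                          ∎

  -- `f *P g` unfolds to `concatMap (λ t → map (t ·T_) g) f`.
  _·T_ : ∀ {n} → Carrier × Mono n → Carrier × Mono n → Carrier × Mono n
  (a , m) ·T (b , m') = (a * b , m ·M m')

  evalTerm : ∀ {n} → Matrix n → Carrier × Mono n → Carrier
  evalTerm z (a , m) = a * evalMono z m

  eval-+P : ∀ {n} (z : Matrix n) f g → eval z (f +P g) ≈ eval z f + eval z g
  eval-+P z f g = trans (reflexive (≡.cong (foldr _+_ 0#) (map-++ (evalTerm z) f g)))
                        (∑.foldr-++ (map (evalTerm z) f) _)

  eval-negP : ∀ {n} (z : Matrix n) f → eval z (-P f) ≈ - eval z f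
  eval-negP z []            = sym -0#≈0#
  eval-negP z ((a , m) ∷ f) =
    trans (+-cong (sym (-‿distribˡ-* a _)) (eval-negP z f)) (-‿+-comm _ _)

  eval--P : ∀ {n} (z : Matrix n) f g → eval z (f -P g) ≈ eval z f - eval z g
  eval--P z f g = trans (eval-+P z f (-P g)) (+-congˡ (eval-negP z g))

  eval-map-·T : ∀ {n} (z : Matrix n) t g → eval z (map (t ·T_) g) ≈ evalTerm z t * eval z g
  eval-map-·T z t       []            = sym (zeroʳ _)
  eval-map-·T z (a , m) ((b , m') ∷ g) = begin
    a * b * evalMono z (m ·M m') + eval z (map ((a , m) ·T_) g)
      ≈⟨ +-cong (*-congˡ (evalMono-·M z m m')) (eval-map-·T z (a , m) g) ⟩
    a * b * (evalMono z m * evalMono z m') + a * evalMono z m * eval z g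
      ≈⟨ +-congʳ (*-interchange a b _ _) ⟩
    a * evalMono z m * (b * evalMono z m') + a * evalMono z m * eval z g
      ≈⟨ distribˡ _ _ _ ⟨
    a * evalMono z m * (b * evalMono z m' + eval z g) ∎

  eval-*P : ∀ {n} (z : Matrix n) f g → eval z (f *P g) ≈ eval z f * eval z g
  eval-*P z []      g = sym (zeroˡ _)
  eval-*P z (t ∷ f) g = begin
    eval z (map (t ·T_) g +P (f *P g))       ≈⟨ eval-+P z (map (t ·T_) g) (f *P g) ⟩
    eval z (map (t ·T_) g) + eval z (f *P g) ≈⟨ +-cong (eval-map-·T z t g) (eval-*P z f g) ⟩
    evalTerm z t * eval z g + eval z f * eval z g ≈⟨ distribʳ _ _ _ ⟨
    (evalTerm z t + eval z f) * eval z g     ∎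

  eval-varP : ∀ {n} (z : Matrix n) i j → eval z (varP i j) ≈ z i j
  eval-varP z i j =
    trans (+-identityʳ _) (trans (*-identityˡ _) (evalMono-varMono z i j))

  eval-constP : ∀ {n} (z : Matrix n) a → eval z (constP a) ≈ a
  eval-constP z a =
    trans (+-identityʳ _) (trans (*-congˡ (evalMono-unitMono z)) (*-identityʳ a))

  eval-∑P : ∀ {n k} (z : Matrix n) (F : Fin k → Pol n) →
    eval z (ΣP (map F (allFin k))) ≈ ∑.sum (λ t → eval z (F t))
  eval-∑P {k = k} z F = trans (go (allFin k)) (∑.foldr-map-allFin (λ t → eval z (F t)))
    where
    go : ∀ ts → eval z (ΣP (map F ts)) ≈ foldr _+_ 0# (map (eval z ∘ F) ts)
    go []       = refl
    go (t ∷ ts) = trans (eval-+P z (F t) _) (+-congˡ (go ts))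

  coeff-term-≡ : ∀ {n} a (M : Mono n) f → coeff ((a , M) ∷ f) M ≈ a + coeff f M
  coeff-term-≡ a M f with M ≟M M
  ... | yes _   = refl
  ... | no M≢M = contradiction ≡.refl M≢M

  coeff-term-≢ : ∀ {n} a {M m : Mono n} f → M ≢ m → coeff ((a , M) ∷ f) m ≈ coeff f m
  coeff-term-≢ a {M} {m} f M≢m with M ≟M m
  ... | yes M≡m = contradiction M≡m M≢m
  ... | no _    = refl

  coeff-+P : ∀ {n} (f g : Pol n) m → coeff (f +P g) m ≈ coeff f m + coeff g m
  coeff-+P []            g m = sym (+-identityˡ _)
  coeff-+P ((a , M) ∷ f) g m with M ≟M m
  ... | yes _ = trans (+-congˡ (coeff-+P f g m)) (sym (+-assoc _ _ _))
  ... | no _  = coeff-+P f g m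

  coeff-negP : ∀ {n} (f : Pol n) m → coeff (-P f) m ≈ - coeff f m
  coeff-negP []            m = sym -0#≈0#
  coeff-negP ((a , M) ∷ f) m with M ≟M m
  ... | yes _ = trans (+-congˡ (coeff-negP f m)) (-‿+-comm a _)
  ... | no _  = coeff-negP f m

  coeff-∑P : ∀ {n k} (F : Fin k → Pol n) m →
    coeff (ΣP (map F (allFin k))) m ≈ ∑.sum (λ t → coeff (F t) m)
  coeff-∑P {k = k} F m = trans (go (allFin k)) (∑.foldr-map-allFin (λ t → coeff (F t) m))
    where
    go : ∀ ts → coeff (ΣP (map F ts)) m ≈ foldr _+_ 0# (map (λ t → coeff (F t) m) ts)
    go []       = refl
    go (t ∷ ts) = trans (coeff-+P (F t) _ m) (+-congˡ (go ts))

  coeff-like-terms : ∀ {n} a b (M : Mono n) f m →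
    coeff ((a , M) ∷ (b , M) ∷ f) m ≈ coeff ((a + b , M) ∷ f) m
  coeff-like-terms a b M f m with M ≟M m
  ... | yes ≡.refl = trans (+-congˡ (coeff-term-≡ b M f)) (sym (+-assoc a b _))
  ... | no M≢m     = coeff-term-≢ b f M≢m

  coeff-zero-term : ∀ {n} {a} (M : Mono n) f m → a ≈ 0# → coeff ((a , M) ∷ f) m ≈ coeff f m
  coeff-zero-term M f m a≈0 with M ≟M m
  ... | yes _ = trans (+-congʳ a≈0) (+-identityˡ _)
  ... | no _  = refl

  Annihilating : ∀ {n} → Pol n → Set (c ⊔ ℓ)
  Annihilating s = ∀ h → (h *P s) ≈P 0P

  cancelling-pair-annihilating : ∀ {n} {a b} (M : Mono n) → a + b ≈ 0# →
    Annihilating ((a , M) ∷ (b , M) ∷ [])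
  cancelling-pair-annihilating M a+b≈0 []            m = refl
  cancelling-pair-annihilating {a = a} {b} M a+b≈0 ((e , N) ∷ h) m = begin
    coeff ((e * a , N ·M M) ∷ (e * b , N ·M M) ∷ (h *P s)) m
      ≈⟨ coeff-like-terms (e * a) (e * b) (N ·M M) (h *P s) m ⟩
    coeff ((e * a + e * b , N ·M M) ∷ (h *P s)) m
      ≈⟨ coeff-zero-term (N ·M M) (h *P s) m ea+eb≈0 ⟩
    coeff (h *P s) m
      ≈⟨ cancelling-pair-annihilating M a+b≈0 h m ⟩
    0# ∎
    where
    s : Pol _
    s = (a , M) ∷ (b , M) ∷ []
    ea+eb≈0 : e * a + e * b ≈ 0#
    ea+eb≈0 = trans (sym (distribˡ e a b)) (trans (*-congˡ a+b≈0) (zeroʳ e))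

  ∈⟨⟩-mono : ∀ {n p q} {S : Pol n → Set p} {T : Pol n → Set q} →
    (∀ {s} → S s → T s ⊎ Annihilating s) → ∀ {f} → f ∈⟨ S ⟩ → f ∈⟨ T ⟩
  ∈⟨⟩-mono {n} {S = S} {T} S⇒T (hs , S-hs , f≈) =
    let hs' , T-hs' , same = drop hs S-hs in hs' , T-hs' , λ m → trans (f≈ m) (same m)
    where
    combination : List (Pol n × Pol n) → Pol n
    combination hs = ΣP (map (λ (h , s) → h *P s) hs)
    drop : ∀ hs → All (S ∘ proj₂) hs →
      ∃[ hs' ] (All (T ∘ proj₂) hs' × combination hs ≈P combination hs')
    drop []            []           = [] , [] , λ m → refl
    drop ((h , s) ∷ hs) (S-s ∷ S-hs) with S⇒T S-s | drop hs S-hs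
    ... | inj₁ T-s   | hs' , T-hs' , same = (h , s) ∷ hs' , T-s ∷ T-hs' , λ m →
          trans (coeff-+P (h *P s) (combination hs) m)
            (trans (+-congˡ (same m)) (sym (coeff-+P (h *P s) (combination hs') m)))
    ... | inj₂ s-ann | hs' , T-hs' , same = hs' , T-hs' , λ m →
          trans (coeff-+P (h *P s) (combination hs) m)
            (trans (+-cong (s-ann h m) (same m)) (+-identityˡ _))

  Homogeneous : ∀ {n} → ℕ → Pol n → Set ℓ
  Homogeneous d f = ∀ m → deg m ≢ d → coeff f m ≈ 0#

  DegreeBelow : ∀ {n} → ℕ → Pol n → Set ℓ
  DegreeBelow d f = ∀ m → d ℕ.≤ deg m → coeff f m ≈ 0#

  term-homogeneous : ∀ {n d} a (M : Mono n) → deg M ≡ d → Homogeneous d ((a , M) ∷ [])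
  term-homogeneous a M deg-M m deg-m≢d =
    coeff-term-≢ a {M} {m} [] (λ M≡m → deg-m≢d (≡.trans (≡.cong deg (≡.sym M≡m)) deg-M))

  term-degreeBelow : ∀ {n d} a (M : Mono n) → deg M ℕ.< d → DegreeBelow d ((a , M) ∷ [])
  term-degreeBelow a M deg-M<d m d≤deg-m =
    coeff-term-≢ a {M} {m} [] (λ { ≡.refl → <⇒≱ deg-M<d d≤deg-m })

  +P-homogeneous : ∀ {n d} {f g : Pol n} →
    Homogeneous d f → Homogeneous d g → Homogeneous d (f +P g)
  +P-homogeneous {f = f} {g} f-hom g-hom m deg-m≢d =
    trans (coeff-+P f g m) (trans (+-cong (f-hom m deg-m≢d) (g-hom m deg-m≢d)) (+-identityˡ 0#))

  negP-degreeBelow : ∀ {n d} {f : Pol n} → DegreeBelow d f → DegreeBelow d (-P f)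
  negP-degreeBelow {f = f} f-below m d≤deg-m =
    trans (coeff-negP f m) (trans (-‿cong (f-below m d≤deg-m)) -0#≈0#)

  homogeneous-∈grGens : ∀ {n p} {Z : Matrix n → Set p} {d} {g r : Pol n} (m₀ : Mono n) →
    Homogeneous d g → deg m₀ ≡ d → coeff g m₀ ≉ 0# → DegreeBelow d r →
    (∀ z → Z z → eval z g ≈ eval z r) → grGens Z g
  homogeneous-∈grGens {Z = Z} {d} {g} {r} m₀ g-hom deg-m₀ g-m₀≉0 r-below g≈r =
    g -P r , vanishes , (m₀ , f-m₀≉0) ,
    d , bounded , (m₀ , deg-m₀ , f-m₀≉0) ,
    (λ m deg-m → sym (f≈g-from-d m (≤-reflexive (≡.sym deg-m)))) , g-hom
    where
    f≈g-from-d : ∀ m → d ℕ.≤ deg m → coeff (g -P r) m ≈ coeff g m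
    f≈g-from-d m d≤deg-m = trans (coeff-+P g (-P r) m)
      (trans (+-congˡ (negP-degreeBelow {f = r} r-below m d≤deg-m)) (+-identityʳ _))
    f-m₀≉0 : coeff (g -P r) m₀ ≉ 0#
    f-m₀≉0 f≈0 = g-m₀≉0 (trans (sym (f≈g-from-d m₀ (≤-reflexive (≡.sym deg-m₀)))) f≈0)
    bounded : ∀ m → coeff (g -P r) m ≉ 0# → deg m ℕ.≤ d
    bounded m f-m≉0 with deg m ≤? d
    ... | yes deg≤d = deg≤d
    ... | no deg≰d  = contradiction
      (trans (f≈g-from-d m (<⇒≤ (≰⇒> deg≰d))) (g-hom m (deg≰d ∘ ≤-reflexive))) f-m≉0
    vanishes : I Z (g -P r)
    vanishes z z∈Z = trans (eval--P z g r) (x≈y⇒x∙y⁻¹≈ε (g≈r z z∈Z))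

  sumOfVariables : ∀ {n k} → (Fin k → Fin n) → (Fin k → Fin n) → Pol n
  sumOfVariables r c = ΣP (map (λ t → varP (r t) (c t)) (allFin _))

  sumOfVariables-∈grGens : ∀ {n k p} {Z : Matrix n → Set p} (r c : Fin k → Fin n) →
    (∀ {t t'} → r t ≡ r t' → c t ≡ c t' → t ≡ t') → Fin k →
    (∀ z → Z z → ∑.sum (λ t → z (r t) (c t)) ≈ 1#) → grGens Z (sumOfVariables r c)
  sumOfVariables-∈grGens {n} r c distinct t₀ sum≈1 =
    homogeneous-∈grGens {g = sumOfVariables r c} {r = constP 1#} (x t₀)
      homogeneous (deg-varMono (r t₀) (c t₀)) (≈1⇒≉0 coeff-x-t₀)
      (term-degreeBelow 1# unitMono (≡.subst (ℕ._< 1) (≡.sym (deg-unitMono {n})) (n<1+n 0)))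
      (λ z z∈Z → begin
        eval z (sumOfVariables r c)      ≈⟨ eval-∑P z terms ⟩
        ∑.sum (λ t → eval z (terms t))   ≈⟨ ∑.sum-cong-≋ (λ t → eval-varP z (r t) (c t)) ⟩
        ∑.sum (λ t → z (r t) (c t))      ≈⟨ sum≈1 z z∈Z ⟩
        1#                               ≈⟨ eval-constP z 1# ⟨
        eval z (constP 1#)               ∎)
    where
    x : Fin _ → Mono n
    x t = varMono (r t) (c t)
    terms : Fin _ → Pol n
    terms t = varP (r t) (c t)
    homogeneous : Homogeneous 1 (sumOfVariables r c)
    homogeneous m deg-m≢1 = trans (coeff-∑P terms m)
      (∑.sum-ε (λ t → term-homogeneous 1# (x t) (deg-varMono (r t) (c t)) m deg-m≢1))
    x-t≢x-t₀ : ∀ {t} → t ≢ t₀ → x t ≢ x t₀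
    x-t≢x-t₀ t≢t₀ xt≡xt₀ = let rc-t≡rc-t₀ = varMono-injective xt≡xt₀ in
      t≢t₀ (distinct (,-injectiveˡ rc-t≡rc-t₀) (,-injectiveʳ rc-t≡rc-t₀))
    coeff-x-t₀ : coeff (sumOfVariables r c) (x t₀) ≈ 1#
    coeff-x-t₀ = begin
      coeff (sumOfVariables r c) (x t₀)   ≈⟨ coeff-∑P terms (x t₀) ⟩
      ∑.sum (λ t → coeff (terms t) (x t₀))
        ≈⟨ ∑.sum-single (λ t → coeff (terms t) (x t₀)) t₀
             (λ t t≢t₀ → coeff-term-≢ 1# {x t} {x t₀} [] (x-t≢x-t₀ t≢t₀)) ⟩
      coeff (terms t₀) (x t₀)              ≈⟨ coeff-term-≡ 1# (x t₀) [] ⟩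
      1# + 0#                              ≈⟨ +-identityʳ 1# ⟩
      1#                                   ∎

  product-of-variables-∈grGens : ∀ {n p} {Z : Matrix n → Set p} i j k l (r : Pol n) →
    DegreeBelow 2 r → (∀ z → Z z → z i j * z k l ≈ eval z r) → grGens Z (varP i j *P varP k l)
  product-of-variables-∈grGens {n} i j k l r r-below product≈r =
    homogeneous-∈grGens {g = varP i j *P varP k l} {r = r} M
      (term-homogeneous (1# * 1#) M deg-M) deg-M
      (≈1⇒≉0 (trans (coeff-term-≡ (1# * 1#) M []) (trans (+-identityʳ _) (*-identityˡ 1#))))
      r-below
      (λ z z∈Z → trans (eval-*P z (varP i j) (varP k l))
        (trans (*-cong (eval-varP z i j) (eval-varP z k l)) (product≈r z z∈Z)))
    where
    M : Mono n
    M = varMono i j ·M varMono k l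
    deg-M : deg M ≡ 2
    deg-M = ≡.trans (deg-·M (varMono i j) (varMono k l))
                    (≡.cong₂ ℕ._+_ (deg-varMono i j) (deg-varMono k l))

  square-of-variable-∈grGens : ∀ {n p} {Z : Matrix n → Set p} i j →
    (∀ z → Z z → z i j * z i j ≈ z i j) → grGens Z (varP i j *P varP i j)
  square-of-variable-∈grGens i j square≈ =
    product-of-variables-∈grGens i j i j (varP i j)
      (term-degreeBelow 1# (varMono i j) (≡.subst (ℕ._< 2) (≡.sym (deg-varMono i j)) (n<1+n 1)))
      (λ z z∈Z → trans (square≈ z z∈Z) (sym (eval-varP z i j)))

  difference-of-variables-∈grGens : ∀ {n p} {Z : Matrix n → Set p} {i j k l} →
    (i , j) ≢ (k , l) → (∀ z → Z z → z i j ≈ z k l) → grGens Z (varP i j -P varP k l)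
  difference-of-variables-∈grGens {i = i} {j} {k} {l} ij≢kl zij≈zkl =
    homogeneous-∈grGens {g = varP i j -P varP k l} {r = 0P} (varMono i j)
      (+P-homogeneous {f = varP i j} { -P varP k l}
        (term-homogeneous 1# (varMono i j) (deg-varMono i j))
        (term-homogeneous (- 1#) (varMono k l) (deg-varMono k l)))
      (deg-varMono i j)
      (≈1⇒≉0 (trans (coeff-term-≡ 1# (varMono i j) _)
        (trans (+-congˡ (coeff-term-≢ (- 1#) [] (ij≢kl ∘ ≡.sym ∘ varMono-injective)))
               (+-identityʳ 1#))))
      (λ _ _ → refl)
      (λ z z∈Z → trans (eval--P z (varP i j) (varP k l))
        (trans (+-cong (eval-varP z i j) (-‿cong (eval-varP z k l)))
               (x≈y⇒x∙y⁻¹≈ε (zij≈zkl z z∈Z))))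

  permMatrix-≡ : ∀ {n} (σ : Fin n → Fin n) {i j} → σ i ≡ j → permMatrix σ i j ≈ 1#
  permMatrix-≡ σ {i} {j} σi≡j with σ i ≟F j
  ... | yes _    = refl
  ... | no σi≢j = contradiction σi≡j σi≢j

  permMatrix-≢ : ∀ {n} (σ : Fin n → Fin n) {i j} → σ i ≢ j → permMatrix σ i j ≈ 0#
  permMatrix-≢ σ {i} {j} σi≢j with σ i ≟F j
  ... | yes σi≡j = contradiction σi≡j σi≢j
  ... | no _     = refl

  permMatrix-row-sum : ∀ {n} (σ : Fin n → Fin n) i → ∑.sum (permMatrix σ i) ≈ 1#
  permMatrix-row-sum σ i = trans
    (∑.sum-single (permMatrix σ i) (σ i) (λ j j≢σi → permMatrix-≢ σ (j≢σi ∘ ≡.sym)))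
    (permMatrix-≡ σ ≡.refl)

  permMatrix-row-orthogonal : ∀ {n} (σ : Fin n → Fin n) i {j j'} → j ≢ j' →
    permMatrix σ i j * permMatrix σ i j' ≈ 0#
  permMatrix-row-orthogonal σ i {j} {j'} j≢j' with σ i ≟F j
  ... | yes σi≡j = trans (*-congˡ (permMatrix-≢ σ (j≢j' ∘ ≡.trans (≡.sym σi≡j)))) (zeroʳ _)
  ... | no _     = zeroˡ _

  permMatrix-idempotent : ∀ {n} (σ : Fin n → Fin n) i j →
    permMatrix σ i j * permMatrix σ i j ≈ permMatrix σ i j
  permMatrix-idempotent σ i j with σ i ≟F j
  ... | yes _ = *-identityˡ _
  ... | no _  = zeroˡ _

  permMatrix-symmetric : ∀ {n} (σ : Fin n → Fin n) → IsInvolution σ → ∀ i j →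
    permMatrix σ i j ≈ permMatrix σ j i
  permMatrix-symmetric σ σσ≡id i j with σ i ≟F j
  ... | yes σi≡j = sym (permMatrix-≡ σ (≡.trans (≡.cong σ (≡.sym σi≡j)) (σσ≡id i)))
  ... | no σi≢j  = sym (permMatrix-≢ σ {j} {i} λ σj≡i →
                     σi≢j (≡.trans (≡.cong σ (≡.sym σj≡i)) (σσ≡id j)))

  ℳ-symmetric : ∀ {n} {z : Matrix n} → ℳ n z → ∀ i j → z i j ≈ z j i
  ℳ-symmetric (σ , σσ≡id , z≈σ) i j =
    trans (z≈σ i j) (trans (permMatrix-symmetric σ σσ≡id i j) (sym (z≈σ j i)))

  ℳ-row-sum : ∀ {n} {z : Matrix n} → ℳ n z → ∀ i → ∑.sum (z i) ≈ 1#
  ℳ-row-sum (σ , _ , z≈σ) i = trans (∑.sum-cong-≋ (z≈σ i)) (permMatrix-row-sum σ i)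

  ℳ-row-orthogonal : ∀ {n} {z : Matrix n} → ℳ n z → ∀ i {j j'} → j ≢ j' → z i j * z i j' ≈ 0#
  ℳ-row-orthogonal (σ , _ , z≈σ) i {j} {j'} j≢j' =
    trans (*-cong (z≈σ i j) (z≈σ i j')) (permMatrix-row-orthogonal σ i j≢j')

  ℳ-idempotent : ∀ {n} {z : Matrix n} → ℳ n z → ∀ i j → z i j * z i j ≈ z i j
  ℳ-idempotent (σ , _ , z≈σ) i j =
    trans (*-cong (z≈σ i j) (z≈σ i j)) (trans (permMatrix-idempotent σ i j) (sym (z≈σ i j)))

  generator-∈grGens : ∀ {n s} → GensM {n} s → grGens (ℳ n) s ⊎ Annihilating s
  generator-∈grGens (row i) = inj₁ (sumOfVariables-∈grGens (λ _ → i) id (λ _ j≡j' → j≡j') i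
    λ _ z∈ℳ → ℳ-row-sum z∈ℳ i)
  generator-∈grGens (col j) = inj₁ (sumOfVariables-∈grGens id (λ _ → j) (λ i≡i' _ → i≡i') j
    λ _ z∈ℳ → trans (∑.sum-cong-≋ (λ i → ℳ-symmetric z∈ℳ i j)) (ℳ-row-sum z∈ℳ j))
  generator-∈grGens (rowP i j j') with j ≟F j'
  ... | yes ≡.refl = inj₁ (square-of-variable-∈grGens i j λ _ z∈ℳ → ℳ-idempotent z∈ℳ i j)
  ... | no j≢j'    = inj₁ (product-of-variables-∈grGens i j i j' 0P (λ _ _ → refl)
    λ _ z∈ℳ → ℳ-row-orthogonal z∈ℳ i j≢j')
  generator-∈grGens (colP i i' j) with i ≟F i'
  ... | yes ≡.refl = inj₁ (square-of-variable-∈grGens i j λ _ z∈ℳ → ℳ-idempotent z∈ℳ i j)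
  ... | no i≢i'    = inj₁ (product-of-variables-∈grGens i j i' j 0P (λ _ _ → refl)
    λ _ z∈ℳ → trans (*-cong (ℳ-symmetric z∈ℳ i j) (ℳ-symmetric z∈ℳ i' j))
                     (ℳ-row-orthogonal z∈ℳ j i≢i'))
  generator-∈grGens (symm i j) with i ≟F j
  ... | yes ≡.refl = inj₂ (cancelling-pair-annihilating (varMono i i) (-‿inverseʳ 1#))
  ... | no i≢j     = inj₁ (difference-of-variables-∈grGens (i≢j ∘ ,-injectiveˡ)
    λ _ z∈ℳ → ℳ-symmetric z∈ℳ i j)

lemma3p2 : ∀ {c ℓ} (K : Field c ℓ) (n : ℕ) → let open Poly K in
    ∀ f → IM n f → gr-I (ℳ n) f
lemma3p2 K n f = ∈⟨⟩-mono K (generator-∈grGens K) {f}
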